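{- For any integers $n\ge 3$, $b\ge 1$ and $k$ with $0\le k<b$, we have $\mathsf{sep}(C_n,b+k,b)\le k$, where $C_n$ is the cycle on $n$ vertices.
   Context: All graphs are finite and simple. For integers $a\ge b\ge 1$ and $c\ge 0$: an $a$-list assignment of a graph $G$ is a function $L$ assigning to each vertex $v$ a set $L(v)$ of exactly $a$ integers (colors). It is $c$-separating if $|L(u)\cap L(v)|\le c$ for every edge $uv$. An $(L,b)$-coloring of $G$ is a function $\varphi$ assigning to each vertex $v$ a set $\varphi(v)\subseteq L(v)$ with $|\varphi(v)|=b$ such that $\varphi(u)\cap\varphi(v)=\emptyset$ for every edge $uv$. $G$ is $(a,b,c)$-choosable if for every $c$-separating $a$-list assignment $L$ of $G$ there exists an $(L,b)$-coloring of $G$. The separation number is $\mathsf{sep}(G,a,b)=\max\{c\ge 0 : G \text{ is } (a,b,c)\text{ -choosable}\}$. -}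

module Defs where

open import Data.Nat using (ℕ; zero; suc; _≤_)
open import Data.Integer using (ℤ)
open import Data.Integer.Properties using () renaming (_≟_ to _≟ℤ_)
open import Data.Fin using (Fin; toℕ)
open import Data.List using (List; length; filter)
open import Data.List.Membership.Propositional using (_∈_)
open import Data.List.Membership.DecPropositional _≟ℤ_ using (_∈?_)
open import Data.List.Relation.Unary.Unique.Propositional using (Unique)
open import Data.Product using (Σ; _×_)
open import Data.Sum using (_⊎_)
open import Relation.Binary.PropositionalEquality using (_≡_)
open import Relation.Nullary using (¬_)

record Graph : Set₁ where
  field
    V   : ℕ
    Adj : Fin V → Fin V → Set
open Graph public

-- The cycle C_n on vertices 0,1,…,n-1: i ~ j iff j = i+1 or i = j+1 (mod n).
-- (A simple graph, i.e. a genuine cycle, when n ≥ 3.)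
Cycle : ℕ → Graph
Cycle n = record
  { V   = n
  ; Adj = λ i j →
      (toℕ j ≡ suc (toℕ i)) ⊎ (toℕ i ≡ suc (toℕ j))
      ⊎ ((toℕ i ≡ 0 × suc (toℕ j) ≡ n) ⊎ (toℕ j ≡ 0 × suc (toℕ i) ≡ n))
  }

record FinSetℤ (m : ℕ) : Set where
  constructor mkSet
  field
    elems  : List ℤ
    unique : Unique elems
    size   : length elems ≡ m
open FinSetℤ public

∣_∩_∣ : {m m' : ℕ} → FinSetℤ m → FinSetℤ m' → ℕ
∣ A ∩ B ∣ = length (filter (_∈? elems B) (elems A))

ListAssignment : Graph → ℕ → Set
ListAssignment G a = Fin (V G) → FinSetℤ a

Separating : (G : Graph) {a : ℕ} → ListAssignment G a → ℕ → Set
Separating G L c = ∀ u v → Adj G u v → ∣ L u ∩ L v ∣ ≤ c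

IsColoring : (G : Graph) {a : ℕ} → ListAssignment G a → (b : ℕ) →
             (Fin (V G) → FinSetℤ b) → Set
IsColoring G L b φ =
  (∀ v x → x ∈ elems (φ v) → x ∈ elems (L v)) ×
  (∀ u v → Adj G u v → ∀ x → x ∈ elems (φ u) → ¬ (x ∈ elems (φ v)))

Choosable : Graph → ℕ → ℕ → ℕ → Set
Choosable G a b c =
  (L : ListAssignment G a) → Separating G L c →
  Σ (Fin (V G) → FinSetℤ b) (IsColoring G L b)

-- sep(G,a,b) ≤ k : every c ≥ 0 for which G is (a,b,c)-choosable satisfies c ≤ k
SepAtMost : Graph → ℕ → ℕ → ℕ → Set
SepAtMost G a b k = ∀ c → Choosable G a b c → c ≤ k

-- Take n = ℓ + 1 and colours in ℕ. Vertex i < ℓ gets the window [ib, ib + b + k) and the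
-- last vertex ℓ gets [ℓb, ℓb + b − 1) ∪ [0, k]. Consecutive lists share at most k + 1
-- colours, so the assignment is c-separating for every c > k, non-adjacent lists are
-- disjoint, and all lists lie in [0, (ℓ + 1)b − 1). A colouring would pick pairwise disjoint
-- b-sets for the ℓ + 1 vertices, i.e. (ℓ + 1)b distinct colours from fewer.
module Submission where

open import Defs
open import Data.Nat.Base using (ℕ; suc; _+_; _*_; _≤_; _<_; z≤n; s≤s; s≤s⁻¹)
open import Data.Nat.Properties
import Data.Integer.Base as ℤ
import Data.Integer.Properties as ℤ
open import Data.Fin.Base using (Fin; toℕ)
open import Data.Fin.Properties using (toℕ<n; toℕ-injective)
open import Data.List.Base using (List; []; _∷_; _++_; length; map; filter; concatMap; applyUpTo; allFin)
open import Data.List.Properties using (length-map; length-++; length-removeAt′; length-applyUpTo; length-tabulate)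
open import Data.List.Membership.Propositional using (_∈_)
open import Data.List.Membership.DecPropositional ℤ._≟_ using (_∈?_)
open import Data.List.Membership.Propositional.Properties
  using (∈-map⁻; ∈-map⁺; ∈-++⁻; ∈-filter⁻; ∈-concat⁻; ∈-applyUpTo⁻; ∈-applyUpTo⁺)
open import Data.List.Relation.Unary.Any using (here; there; index; _─_)
import Data.List.Relation.Unary.Any as Any
import Data.List.Relation.Unary.Any.Properties as Any
import Data.List.Relation.Unary.All as All
import Data.List.Relation.Unary.All.Properties as All
open import Data.List.Relation.Unary.AllPairs using (_∷_)
import Data.List.Relation.Unary.AllPairs as AllPairs
import Data.List.Relation.Unary.AllPairs.Properties as AllPairs
open import Data.List.Relation.Unary.Unique.Propositional using (Unique)
import Data.List.Relation.Unary.Unique.Propositional.Properties as Unique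
open import Data.List.Relation.Binary.Subset.Propositional using (_⊆_)
open import Data.List.Relation.Binary.Disjoint.Propositional using (Disjoint)
open import Data.Product.Base using (∃; _×_; _,_; proj₁; proj₂)
open import Data.Sum.Base using (_⊎_; inj₁; inj₂; swap)
open import Function.Base using (id; _∘_)
open import Relation.Nullary using (¬_; yes; no)
open import Relation.Nullary.Negation using (contradiction)
open import Relation.Binary.Definitions using (tri<; tri≈; tri>)
open import Relation.Binary.PropositionalEquality

module _ {A : Set} where

  ∈-─⁺ : ∀ {x y} {ys : List A} (x∈ys : x ∈ ys) → y ∈ ys → x ≢ y → y ∈ (ys ─ x∈ys)
  ∈-─⁺ (here refl)  (here refl)  x≢y = contradiction refl x≢y
  ∈-─⁺ (here refl)  (there y∈ys) _   = y∈ys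
  ∈-─⁺ (there _)    (here refl)  _   = here refl
  ∈-─⁺ (there x∈ys) (there y∈ys) x≢y = there (∈-─⁺ x∈ys y∈ys x≢y)

  Unique-⊆⇒length-≤ : ∀ {xs ys : List A} → Unique xs → xs ⊆ ys → length xs ≤ length ys
  Unique-⊆⇒length-≤ {[]}     _            _     = z≤n
  Unique-⊆⇒length-≤ {x ∷ xs} {ys} (x∉xs ∷ xs!) xs⊆ys = begin
    suc (length xs)          ≤⟨ s≤s (Unique-⊆⇒length-≤ xs! xs⊆ys─x) ⟩
    suc (length (ys ─ x∈ys)) ≡⟨ length-removeAt′ ys (index x∈ys) ⟨
    length ys                ∎
    where
    open ≤-Reasoning
    x∈ys : x ∈ ys
    x∈ys = xs⊆ys (here refl)
    xs⊆ys─x : xs ⊆ (ys ─ x∈ys)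
    xs⊆ys─x y∈xs = ∈-─⁺ x∈ys (xs⊆ys (there y∈xs)) (All.lookup x∉xs y∈xs)

∣∩∣≤length : ∀ {m m′} (A : FinSetℤ m) (B : FinSetℤ m′) {R : List ℤ.ℤ} →
             (∀ {z} → z ∈ elems A → z ∈ elems B → z ∈ R) → ∣ A ∩ B ∣ ≤ length R
∣∩∣≤length A B common = Unique-⊆⇒length-≤ (Unique.filter⁺ (_∈? elems B) (unique A)) A∩B⊆R
  where
  A∩B⊆R : filter (_∈? elems B) (elems A) ⊆ _
  A∩B⊆R z∈A∩B = let z∈A , z∈B = ∈-filter⁻ (_∈? elems B) z∈A∩B in common z∈A z∈B

module _ {I : Set} {m : ℕ} (S : I → FinSetℤ m) where

  private
    ⋃ : List I → List ℤ.ℤ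
    ⋃ = concatMap (elems ∘ S)

    length-⋃ : ∀ is → length (⋃ is) ≡ length is * m
    length-⋃ []       = refl
    length-⋃ (i ∷ is) = trans (length-++ (elems (S i))) (cong₂ _+_ (size (S i)) (length-⋃ is))

  disjoint-family-size≤ : ∀ {is R} → Unique is →
    (∀ {i j} → i ≢ j → Disjoint (elems (S i)) (elems (S j))) →
    (∀ i → elems (S i) ⊆ R) → length is * m ≤ length R
  disjoint-family-size≤ {is} {R} is! disjoint S⊆R =
    subst (_≤ length R) (length-⋃ is) (Unique-⊆⇒length-≤ ⋃-unique ⋃⊆R)
    where
    ⋃-unique : Unique (⋃ is)
    ⋃-unique = Unique.concat⁺ (All.map⁺ (All.universal (unique ∘ S) is))
                              (AllPairs.map⁺ (AllPairs.map disjoint is!))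
    ⋃⊆R : ⋃ is ⊆ R
    ⋃⊆R z∈⋃ = let i , z∈Si = Any.satisfied (Any.map⁻ (∈-concat⁻ (map (elems ∘ S) is) z∈⋃))
              in S⊆R i z∈Si

fromℕs : ∀ {m} (xs : List ℕ) → Unique xs → length xs ≡ m → FinSetℤ m
fromℕs xs xs! ∣xs∣ =
  mkSet (map ℤ.+_ xs) (Unique.map⁺ ℤ.+-injective xs!) (trans (length-map ℤ.+_ xs) ∣xs∣)

interval : ℕ → ℕ → List ℕ
interval a l = applyUpTo (a +_) l

∈-interval⁻ : ∀ {a l x} → x ∈ interval a l → a ≤ x × x < a + l
∈-interval⁻ {a} x∈ with ∈-applyUpTo⁻ (a +_) x∈
... | j , j<l , refl = m≤m+n a j , +-monoʳ-< a j<l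

∈-interval⁺ : ∀ {a l x} → a ≤ x → x < a + l → x ∈ interval a l
∈-interval⁺ {a} {l} a≤x x<a+l = subst (_∈ interval a l) (m+[n∸m]≡n a≤x)
  (∈-applyUpTo⁺ (a +_) (+-cancelˡ-< a _ l (subst (_< a + l) (sym (m+[n∸m]≡n a≤x)) x<a+l)))

interval-unique : ∀ a l → Unique (interval a l)
interval-unique a l = Unique.applyUpTo⁺₁ (a +_) l (λ i<j _ → <⇒≢ i<j ∘ +-cancelˡ-≡ a _ _)

length-interval : ∀ a l → length (interval a l) ≡ l
length-interval a = length-applyUpTo (a +_)

block-< : ∀ {a c b x} → a * b ≤ x → x < c * b → a < c
block-< {a} {c} {b} a*b≤x x<c*b = *-cancelʳ-< b a c (≤-<-trans a*b≤x x<c*b)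

module Counterexample (ℓ b′ k : ℕ) (2≤ℓ : 2 ≤ ℓ) (k≤b′ : k ≤ b′) where

  b : ℕ
  b = suc b′

  ℓ≮2 : ¬ ℓ < 2
  ℓ≮2 = ≤⇒≯ 2≤ℓ

  1≤ℓ : 1 ≤ ℓ
  1≤ℓ = ≤-trans (n≤1+n 1) 2≤ℓ

  k<1*b : k < 1 * b
  k<1*b = subst (k <_) (sym (*-identityˡ b)) (s≤s k≤b′)

  window-end : ∀ i → suc i * b + k < suc (suc i) * b
  window-end i = subst (suc i * b + k <_) (+-comm (suc i * b) b) (+-monoʳ-< (suc i * b) (s≤s k≤b′))

  window-end-≡ : ∀ i → i * b + (b + k) ≡ suc i * b + k
  window-end-≡ i = trans (sym (+-assoc (i * b) b k)) (cong (_+ k) (+-comm (i * b) b))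

  colours : ℕ → List ℕ
  colours i with i ≟ ℓ
  ... | no  _ = interval (i * b) (b + k)
  ... | yes _ = interval (ℓ * b) b′ ++ interval 0 (suc k)

  colours-unique : ∀ i → Unique (colours i)
  colours-unique i with i ≟ ℓ
  ... | no  _ = interval-unique (i * b) (b + k)
  ... | yes _ = Unique.++⁺ (interval-unique (ℓ * b) b′) (interval-unique 0 (suc k)) apart
    where
    apart : ∀ {x} → ¬ (x ∈ interval (ℓ * b) b′ × x ∈ interval 0 (suc k))
    apart (x∈top , x∈wrap) = ℓ≮2 (m<n⇒m<1+n (block-< (proj₁ (∈-interval⁻ x∈top))
                                                     (<-≤-trans (proj₂ (∈-interval⁻ x∈wrap)) k<1*b)))

  length-colours : ∀ i → length (colours i) ≡ b + k
  length-colours i with i ≟ ℓ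
  ... | no  _ = length-interval (i * b) (b + k)
  ... | yes _ = begin
    length (interval (ℓ * b) b′ ++ interval 0 (suc k))
      ≡⟨ length-++ (interval (ℓ * b) b′) ⟩
    length (interval (ℓ * b) b′) + length (interval 0 (suc k))
      ≡⟨ cong₂ _+_ (length-interval (ℓ * b) b′) (length-interval 0 (suc k)) ⟩
    b′ + suc k
      ≡⟨ +-suc b′ k ⟩
    b + k ∎
    where open ≡-Reasoning

  data Colour (i x : ℕ) : Set where
    window : i ≢ ℓ → i * b ≤ x → x < suc i * b + k → Colour i x
    top    : i ≡ ℓ → i * b ≤ x → x < i * b + b′ → Colour i x
    wrap   : i ≡ ℓ → x ≤ k → Colour i x

  ∈-colours⁻ : ∀ {i x} → x ∈ colours i → Colour i x
  ∈-colours⁻ {i} {x} x∈ with i ≟ ℓ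
  ... | no i≢ℓ = let i*b≤x , x<end = ∈-interval⁻ x∈ in
    window i≢ℓ i*b≤x (subst (x <_) (window-end-≡ i) x<end)
  ... | yes refl with ∈-++⁻ (interval (ℓ * b) b′) x∈
  ...   | inj₁ x∈top  = let ℓ*b≤x , x<end = ∈-interval⁻ x∈top in top refl ℓ*b≤x x<end
  ...   | inj₂ x∈wrap = wrap refl (s≤s⁻¹ (proj₂ (∈-interval⁻ x∈wrap)))

  window-of : ∀ {i x} → i ≢ ℓ → Colour i x → i * b ≤ x × x < suc i * b + k
  window-of _   (window _ i*b≤x x<end) = i*b≤x , x<end
  window-of i≢ℓ (top i≡ℓ _ _)          = contradiction i≡ℓ i≢ℓ
  window-of i≢ℓ (wrap i≡ℓ _)           = contradiction i≡ℓ i≢ℓ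

  colour-lower-bound : ∀ {i x} → Colour i x → i * b ≤ x ⊎ (i ≡ ℓ × x ≤ k)
  colour-lower-bound (window _ i*b≤x _) = inj₁ i*b≤x
  colour-lower-bound (top _ i*b≤x _)    = inj₁ i*b≤x
  colour-lower-bound (wrap i≡ℓ x≤k)     = inj₂ (i≡ℓ , x≤k)

  colour-upper-bound : ∀ {i x} → i ≤ ℓ → Colour i x → x < ℓ * b + b′
  colour-upper-bound i≤ℓ (window i≢ℓ _ x<end) =
    <-≤-trans x<end (+-mono-≤ (*-monoˡ-≤ b (≤∧≢⇒< i≤ℓ i≢ℓ)) k≤b′)
  colour-upper-bound _ (top refl _ x<end) = x<end
  colour-upper-bound {x = x} _ (wrap _ x≤k) = begin-strict
    x          ≤⟨ x≤k ⟩
    k          <⟨ k<1*b ⟩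
    1 * b      ≤⟨ *-monoˡ-≤ b 1≤ℓ ⟩
    ℓ * b      ≤⟨ m≤m+n (ℓ * b) b′ ⟩
    ℓ * b + b′ ∎
    where open ≤-Reasoning

  too-few-colours : ¬ (suc ℓ * b ≤ ℓ * b + b′)
  too-few-colours = subst (λ t → ¬ (suc t ≤ ℓ * b + b′)) (+-comm (ℓ * b) b′) (n≮n (ℓ * b + b′))

  -- Shaped like the clauses of the adjacency relation of Cycle (suc ℓ).
  Next : ℕ → ℕ → Set
  Next i j = j ≡ suc i ⊎ (j ≡ 0 × suc i ≡ suc ℓ)

  overlap⇒next< : ∀ {i j x} → i < j → j ≤ ℓ → Colour i x → Colour j x → Next i j ⊎ Next j i
  overlap⇒next< {i} i<j j≤ℓ ci cj
    with window-of (<⇒≢ (<-≤-trans i<j j≤ℓ)) ci | colour-lower-bound cj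
  ... | _ , x<end | inj₁ j*b≤x =
    inj₁ (inj₁ (≤-antisym (s≤s⁻¹ (block-< j*b≤x (<-trans x<end (window-end i)))) i<j))
  ... | i*b≤x , _ | inj₂ (j≡ℓ , x≤k) =
    inj₂ (inj₂ (n<1⇒n≡0 (block-< i*b≤x (≤-<-trans x≤k k<1*b)) , cong suc j≡ℓ))

  overlap⇒next : ∀ {i j x} → i ≤ ℓ → j ≤ ℓ → i ≢ j →
                 Colour i x → Colour j x → Next i j ⊎ Next j i
  overlap⇒next {i} {j} i≤ℓ j≤ℓ i≢j ci cj with <-cmp i j
  ... | tri< i<j _ _ = overlap⇒next< i<j j≤ℓ ci cj
  ... | tri≈ _ i≡j _ = contradiction i≡j i≢j
  ... | tri> _ _ j<i = swap (overlap⇒next< j<i i≤ℓ cj ci)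

  shared-colour : ∀ {i j x} → Next i j → j ≤ ℓ →
                  Colour i x → Colour j x → x ∈ interval (j * b) (suc k)
  shared-colour {i} (inj₁ refl) i<ℓ ci cj with window-of (<⇒≢ i<ℓ) ci | colour-lower-bound cj
  ... | _ , x<end | inj₁ j*b≤x =
    ∈-interval⁺ j*b≤x (<-≤-trans x<end (+-monoʳ-≤ (suc i * b) (n≤1+n k)))
  ... | i*b≤x , _ | inj₂ (1+i≡ℓ , x≤k) =
    contradiction (subst (_< 2) 1+i≡ℓ (s≤s (block-< i*b≤x (≤-<-trans x≤k k<1*b)))) ℓ≮2
  shared-colour (inj₂ (refl , 1+i≡1+ℓ)) _ ci cj with window-of (<⇒≢ 1≤ℓ) cj | colour-lower-bound ci
  ... | _ , x<end | inj₁ i*b≤x =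
    contradiction (subst (_< 2) (suc-injective 1+i≡1+ℓ)
                         (block-< i*b≤x (<-trans x<end (window-end 0)))) ℓ≮2
  ... | _ | inj₂ (_ , x≤k) = ∈-interval⁺ z≤n (s≤s x≤k)

  C : Graph
  C = Cycle (suc ℓ)

  L : ListAssignment C (b + k)
  L v = fromℕs (colours (toℕ v)) (colours-unique (toℕ v)) (length-colours (toℕ v))

  vertex≤ℓ : (v : Fin (suc ℓ)) → toℕ v ≤ ℓ
  vertex≤ℓ v = s≤s⁻¹ (toℕ<n v)

  adj⇒next : ∀ {u v} → Adj C u v → Next (toℕ u) (toℕ v) ⊎ Next (toℕ v) (toℕ u)
  adj⇒next (inj₁ v≡1+u)                 = inj₁ (inj₁ v≡1+u)
  adj⇒next (inj₂ (inj₁ u≡1+v))          = inj₂ (inj₁ u≡1+v)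
  adj⇒next (inj₂ (inj₂ (inj₁ wrap-vu))) = inj₂ (inj₂ wrap-vu)
  adj⇒next (inj₂ (inj₂ (inj₂ wrap-uv))) = inj₁ (inj₂ wrap-uv)

  next⇒adj : ∀ {u v} → Next (toℕ u) (toℕ v) ⊎ Next (toℕ v) (toℕ u) → Adj C u v
  next⇒adj (inj₁ (inj₁ v≡1+u))   = inj₁ v≡1+u
  next⇒adj (inj₂ (inj₁ u≡1+v))   = inj₂ (inj₁ u≡1+v)
  next⇒adj (inj₂ (inj₂ wrap-vu)) = inj₂ (inj₂ (inj₁ wrap-vu))
  next⇒adj (inj₁ (inj₂ wrap-uv)) = inj₂ (inj₂ (inj₂ wrap-uv))

  common-colour : ∀ {u v z} → z ∈ elems (L u) → z ∈ elems (L v) →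
                  ∃ λ x → z ≡ ℤ.+ x × Colour (toℕ u) x × Colour (toℕ v) x
  common-colour z∈u z∈v with ∈-map⁻ ℤ.+_ z∈u | ∈-map⁻ ℤ.+_ z∈v
  ... | x , x∈u , refl | y , y∈v , +x≡+y =
    x , refl , ∈-colours⁻ x∈u , ∈-colours⁻ (subst (_∈ _) (sym (ℤ.+-injective +x≡+y)) y∈v)

  ∣∩∣≤1+k : ∀ (u v w : Fin (suc ℓ)) →
            (∀ {x} → Colour (toℕ u) x → Colour (toℕ v) x → x ∈ interval (toℕ w * b) (suc k)) →
            ∣ L u ∩ L v ∣ ≤ suc k
  ∣∩∣≤1+k u v w within =
    subst (∣ L u ∩ L v ∣ ≤_) (trans (length-map ℤ.+_ R) (length-interval (toℕ w * b) (suc k)))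
          (∣∩∣≤length (L u) (L v) shared∈R)
    where
    R : List ℕ
    R = interval (toℕ w * b) (suc k)
    shared∈R : ∀ {z} → z ∈ elems (L u) → z ∈ elems (L v) → z ∈ map ℤ.+_ R
    shared∈R z∈u z∈v with common-colour {u} {v} z∈u z∈v
    ... | x , refl , cu , cv = ∈-map⁺ ℤ.+_ (within cu cv)

  L-separating : ∀ {c} → k < c → Separating C L c
  L-separating k<c u v uv = ≤-trans (∩-bound (adj⇒next uv)) k<c
    where
    ∩-bound : Next (toℕ u) (toℕ v) ⊎ Next (toℕ v) (toℕ u) → ∣ L u ∩ L v ∣ ≤ suc k
    ∩-bound (inj₁ u→v) = ∣∩∣≤1+k u v v (λ cu cv → shared-colour u→v (vertex≤ℓ v) cu cv)
    ∩-bound (inj₂ v→u) = ∣∩∣≤1+k u v u (λ cu cv → shared-colour v→u (vertex≤ℓ u) cv cu)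

  no-colouring : (φ : Fin (suc ℓ) → FinSetℤ b) → ¬ IsColoring C L b φ
  no-colouring φ (φ⊆L , proper) = too-few-colours (subst₂ _≤_ ∣vertices∣*b ∣palette∣ family-size)
    where
    palette : List ℤ.ℤ
    palette = map ℤ.+_ (interval 0 (ℓ * b + b′))

    disjoint : ∀ {u v} → u ≢ v → Disjoint (elems (φ u)) (elems (φ v))
    disjoint {u} {v} u≢v (z∈φu , z∈φv) with common-colour {u} {v} (φ⊆L u _ z∈φu) (φ⊆L v _ z∈φv)
    ... | _ , refl , cu , cv =
      proper u v (next⇒adj (overlap⇒next (vertex≤ℓ u) (vertex≤ℓ v) (u≢v ∘ toℕ-injective) cu cv))
             _ z∈φu z∈φv

    φ⊆palette : ∀ v → elems (φ v) ⊆ palette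
    φ⊆palette v z∈φv with ∈-map⁻ ℤ.+_ (φ⊆L v _ z∈φv)
    ... | x , x∈v , refl =
      ∈-map⁺ ℤ.+_ (∈-interval⁺ z≤n (colour-upper-bound (vertex≤ℓ v) (∈-colours⁻ x∈v)))

    family-size : length (allFin (suc ℓ)) * b ≤ length palette
    family-size = disjoint-family-size≤ φ (Unique.allFin⁺ (suc ℓ)) disjoint φ⊆palette

    ∣vertices∣*b : length (allFin (suc ℓ)) * b ≡ suc ℓ * b
    ∣vertices∣*b = cong (_* b) (length-tabulate {n = suc ℓ} id)

    ∣palette∣ : length palette ≡ ℓ * b + b′
    ∣palette∣ = trans (length-map ℤ.+_ (interval 0 (ℓ * b + b′))) (length-interval 0 (ℓ * b + b′))

proposition2 : (n b k : ℕ) → 3 ≤ n → 1 ≤ b → k < b →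
    SepAtMost (Cycle n) (b + k) b k
proposition2 (suc ℓ) (suc b′) k (s≤s 2≤ℓ) (s≤s z≤n) (s≤s k≤b′) c choosable =
  ≮⇒≥ λ k<c → let φ , colouring = choosable L (L-separating k<c) in no-colouring φ colouring
  where open Counterexample ℓ b′ k 2≤ℓ k≤b′
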